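{- Let $N \geq 5$ and let $C_M^\circ$ be a cycle subgraph of $K_N$ (on $[N]$) with $M$ vertices, labeled $v_0,\dots,v_{M-1}$ so that $v_i v_j$ is an edge of the cycle if and only if $j - i \equiv \pm 1 \pmod M$; indices of the $v$'s are taken modulo $M$. Define \[ \mathscr{X} = \{(N-2)\mathbf{e}_{v_i} + \mathbf{e}_j \in \mathbb{R}^N : 0 \leq i \leq M-1,\ j \in [N]\}, \] \[ \mathscr{Y} = \{r\mathbf{e}_{v_i} + (N-1-r)\mathbf{e}_{v_{i+2}} \in \mathbb{R}^N : 0 \le i \le M-1,\ 2 \leq r \leq N-3\}, \] \[ \mathscr{Z} = \{r\mathbf{e}_{v_i} + (N-2-r)\mathbf{e}_{v_{i+2}} + \mathbf{e}_s : 0 \le i \le M-1,\ 1 \leq r \leq N-3,\ s \in [N]\setminus\{v_i,v_{i+2}\}\}. \] Then $\mathscr{X}$, $\mathscr{Y}$, $\mathscr{Z}$ are pairwise disjoint.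
   Context: $\mathbf{e}_j$ denotes the $j$th standard basis vector of $\mathbb{R}^N$. -}

module Defs where

open import Data.Nat using (ℕ; zero; suc; _+_; _*_; _∸_; _≤_; NonZero)
open import Data.Nat.DivMod using (_mod_)
open import Data.Fin using (Fin; toℕ)
open import Data.Fin.Properties using (_≟_)
open import Data.Product using (∃-syntax; _×_)
open import Relation.Nullary using (¬_; yes; no)
open import Relation.Binary.PropositionalEquality using (_≡_; _≢_)

-- Vectors of ℝ^N with (nonnegative) integer entries, represented as Fin N → ℕ.
Vect : ℕ → Set
Vect N = Fin N → ℕ

e : {N : ℕ} → Fin N → Vect N
e j k with j ≟ k
... | yes _ = 1
... | no  _ = 0

infixl 6 _⊕_
infixl 7 _·_

_⊕_ : {N : ℕ} → Vect N → Vect N → Vect N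
(x ⊕ y) k = x k + y k

_·_ : {N : ℕ} → ℕ → Vect N → Vect N
(c · x) k = c * x k

_≐_ : {N : ℕ} → Vect N → Vect N → Set
x ≐ y = ∀ k → x k ≡ y k

plus2 : (M : ℕ) .{{_ : NonZero M}} → Fin M → Fin M
plus2 M i = (toℕ i + 2) mod M

module Sets (N M : ℕ) .{{_ : NonZero M}} (v : Fin M → Fin N) where

  InX : Vect N → Set
  InX x = ∃[ i ] ∃[ j ] (x ≐ ((N ∸ 2) · e (v i) ⊕ e j))

  InY : Vect N → Set
  InY x = ∃[ i ] ∃[ r ] ((2 ≤ r × r ≤ N ∸ 3) ×
            (x ≐ (r · e (v i) ⊕ (N ∸ 1 ∸ r) · e (v (plus2 M i)))))

  InZ : Vect N → Set
  InZ x = ∃[ i ] ∃[ r ] ∃[ s ] ((1 ≤ r × r ≤ N ∸ 3) × (s ≢ v i × s ≢ v (plus2 M i)) ×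
            (x ≐ (r · e (v i) ⊕ (N ∸ 2 ∸ r) · e (v (plus2 M i)) ⊕ e s)))

-- A vector of X has a coordinate N − 2, while every coordinate of a vector of Y or Z is at
-- most N − 3, because the two supporting vertices v_i and v_{i+2} are distinct when M ≥ 3.
-- A vector of Z has a coordinate 1 (at s), while the nonzero coordinates of a vector of Y
-- are r ≥ 2 and N − 1 − r ≥ 2.
module Submission where

open import Defs
open import Data.Nat using (ℕ; _+_; _*_; _∸_; _≤_; _<_; z≤n; NonZero; _%_; _/_)
open import Data.Nat.Properties
open import Data.Nat.DivMod using (m≡m%n+[m/n]*n)
open import Data.Nat.Divisibility using (divides; ∣⇒≤)
open import Data.Fin using (Fin; toℕ)
open import Data.Fin.Properties using (toℕ-fromℕ<) renaming (_≟_ to _≟ᶠ_)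
open import Data.Product using (_×_; _,_; ∃-syntax)
open import Function.Definitions using (Injective)
open import Relation.Nullary using (¬_; Dec; yes; no; contradiction)
open import Relation.Binary.PropositionalEquality
open ≤-Reasoning

m∸n∸o≤m∸[n+k] : ∀ m n {k o} → k ≤ o → m ∸ n ∸ o ≤ m ∸ (n + k)
m∸n∸o≤m∸[n+k] m n k≤o = ≤-trans (∸-monoʳ-≤ (m ∸ n) k≤o) (≤-reflexive (∸-+-assoc m n _))

k≤m∸n∸o : ∀ {m n k o} → k + n ≤ m → o ≤ m ∸ (n + k) → k ≤ m ∸ n ∸ o
k≤m∸n∸o {m} {n} {k} {o} k+n≤m o≤ = begin
  k                           ≡⟨ m∸[m∸n]≡n (m+n≤o⇒m≤o∸n k k+n≤m) ⟨
  m ∸ n ∸ (m ∸ n ∸ k)         ≡⟨ cong (m ∸ n ∸_) (∸-+-assoc m n k) ⟩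
  m ∸ n ∸ (m ∸ (n + k))       ≤⟨ ∸-monoʳ-≤ (m ∸ n) o≤ ⟩
  m ∸ n ∸ o                   ∎

plus2-≢ : ∀ {M} .{{_ : NonZero M}} → 3 ≤ M → (i : Fin M) → plus2 M i ≢ i
plus2-≢ {M} 3≤M i eq = <⇒≱ 3≤M (∣⇒≤ (divides ((toℕ i + 2) / M) 2≡q*M))
  where
  2≡q*M : 2 ≡ (toℕ i + 2) / M * M
  2≡q*M = +-cancelˡ-≡ (toℕ i) _ _ (begin-equality
    toℕ i + 2                                   ≡⟨ m≡m%n+[m/n]*n (toℕ i + 2) M ⟩
    (toℕ i + 2) % M + (toℕ i + 2) / M * M       ≡⟨ cong (_+ (toℕ i + 2) / M * M) (toℕ-fromℕ< _) ⟨
    toℕ (plus2 M i) + (toℕ i + 2) / M * M       ≡⟨ cong (λ j → toℕ j + (toℕ i + 2) / M * M) eq ⟩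
    toℕ i + (toℕ i + 2) / M * M                 ∎)

module _ {N : ℕ} where

  e-diag : (j : Fin N) → e j j ≡ 1
  e-diag j with j ≟ᶠ j
  ... | yes _   = refl
  ... | no j≢j = contradiction refl j≢j

  e-offdiag : {j k : Fin N} → j ≢ k → e j k ≡ 0
  e-offdiag {j} {k} j≢k with j ≟ᶠ k
  ... | yes j≡k = contradiction j≡k j≢k
  ... | no _    = refl

  ·e-diag : ∀ c (j : Fin N) → (c · e j) j ≡ c
  ·e-diag c j = trans (cong (c *_) (e-diag j)) (*-identityʳ c)

  ·e-offdiag : ∀ c {j k : Fin N} → j ≢ k → (c · e j) k ≡ 0
  ·e-offdiag c j≢k = trans (cong (c *_) (e-offdiag j≢k)) (*-zeroʳ c)

  c≤[c·e[p]⊕x]p : ∀ c (p : Fin N) (x : Vect N) → c ≤ (c · e p ⊕ x) p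
  c≤[c·e[p]⊕x]p c p x = begin
    c                   ≤⟨ m≤m+n c (x p) ⟩
    c + x p             ≡⟨ cong (_+ x p) (·e-diag c p) ⟨
    (c · e p ⊕ x) p     ∎

  ⊕e-at : (x : Vect N) {s : Fin N} → x s ≡ 0 → (x ⊕ e s) s ≡ 1
  ⊕e-at x {s} xs≡0 = cong₂ _+_ xs≡0 (e-diag s)

  ⊕e-away : (x : Vect N) {s k : Fin N} → s ≢ k → (x ⊕ e s) k ≡ x k
  ⊕e-away x {k = k} s≢k = trans (cong (x k +_) (e-offdiag s≢k)) (+-identityʳ (x k))

  module _ {p q : Fin N} (p≢q : p ≢ q) (a b : ℕ) where

    pair-at-left : (a · e p ⊕ b · e q) p ≡ a
    pair-at-left = trans (cong₂ _+_ (·e-diag a p) (·e-offdiag b (≢-sym p≢q))) (+-identityʳ a)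

    pair-at-right : (a · e p ⊕ b · e q) q ≡ b
    pair-at-right = cong₂ _+_ (·e-offdiag a p≢q) (·e-diag b q)

    pair-outside : ∀ {k} → p ≢ k → q ≢ k → (a · e p ⊕ b · e q) k ≡ 0
    pair-outside p≢k q≢k = cong₂ _+_ (·e-offdiag a p≢k) (·e-offdiag b q≢k)

    pair-coordinate : (P : ℕ → Set) → P a → P b → P 0 → ∀ k → P ((a · e p ⊕ b · e q) k)
    pair-coordinate P Pa Pb P0 k = by-cases (p ≟ᶠ k) (q ≟ᶠ k)
      where
      by-cases : Dec (p ≡ k) → Dec (q ≡ k) → P ((a · e p ⊕ b · e q) k)
      by-cases (yes refl) (yes refl) = contradiction refl p≢q
      by-cases (yes refl) (no _)     = subst P (sym pair-at-left) Pa
      by-cases (no _)     (yes refl) = subst P (sym pair-at-right) Pb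
      by-cases (no p≢k)   (no q≢k)   = subst P (sym (pair-outside p≢k q≢k)) P0

    pair⊕e-coordinate-≤ : ∀ {s c} → p ≢ s → q ≢ s → a ≤ c → b ≤ c → 1 ≤ c →
                          ∀ k → (a · e p ⊕ b · e q ⊕ e s) k ≤ c
    pair⊕e-coordinate-≤ {s} {c} p≢s q≢s a≤c b≤c 1≤c k = by-cases (s ≟ᶠ k)
      where
      by-cases : Dec (s ≡ k) → (a · e p ⊕ b · e q ⊕ e s) k ≤ c
      by-cases (yes refl) =
        ≤-trans (≤-reflexive (⊕e-at (a · e p ⊕ b · e q) (pair-outside p≢s q≢s))) 1≤c
      by-cases (no s≢k)   = ≤-trans (≤-reflexive (⊕e-away (a · e p ⊕ b · e q) s≢k))
                                    (pair-coordinate (_≤ c) a≤c b≤c z≤n k)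

module _ {N M : ℕ} .{{_ : NonZero M}} (v : Fin M → Fin N) where
  open Sets N M v

  InX⇒∃coordinate-≥ : ∀ {x} → InX x → ∃[ k ] N ∸ 2 ≤ x k
  InX⇒∃coordinate-≥ (i , j , x≐) =
    v i , ≤-trans (c≤[c·e[p]⊕x]p _ (v i) (e j)) (≤-reflexive (sym (x≐ (v i))))

  InZ⇒∃coordinate-≡1 : ∀ {x} → InZ x → ∃[ k ] x k ≡ 1
  InZ⇒∃coordinate-≡1 (i , r , s , _ , (s≢p , s≢q) , x≐) =
    s , trans (x≐ s) (⊕e-at (r · e (v i) ⊕ r′ · e (v (plus2 M i)))
                        (cong₂ _+_ (·e-offdiag r (≢-sym s≢p)) (·e-offdiag r′ (≢-sym s≢q))))
    where r′ = N ∸ 2 ∸ r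

  module _ (v≢v∘plus2 : ∀ i → v i ≢ v (plus2 M i)) where

    InY⇒coordinate-≤ : ∀ {x} → InY x → ∀ k → x k ≤ N ∸ 3
    InY⇒coordinate-≤ (i , r , (2≤r , r≤) , x≐) k = ≤-trans (≤-reflexive (x≐ k))
      (pair-coordinate (v≢v∘plus2 i) r _ (_≤ N ∸ 3) r≤ (m∸n∸o≤m∸[n+k] N 1 2≤r) z≤n k)

    InY⇒coordinate-≢1 : 3 ≤ N → ∀ {x} → InY x → ∀ k → x k ≢ 1
    InY⇒coordinate-≢1 3≤N (i , r , (2≤r , r≤) , x≐) k = λ xk≡1 →
      pair-coordinate (v≢v∘plus2 i) r _ (_≢ 1)
        (λ r≡1 → <⇒≱ 2≤r (≤-reflexive r≡1))
        (λ r′≡1 → <⇒≱ (k≤m∸n∸o 3≤N r≤) (≤-reflexive r′≡1))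
        (λ ()) k (trans (sym (x≐ k)) xk≡1)

    InZ⇒coordinate-≤ : 4 ≤ N → ∀ {x} → InZ x → ∀ k → x k ≤ N ∸ 3
    InZ⇒coordinate-≤ 4≤N (i , r , s , (1≤r , r≤) , (s≢p , s≢q) , x≐) k =
      ≤-trans (≤-reflexive (x≐ k))
      (pair⊕e-coordinate-≤ (v≢v∘plus2 i) r _ (≢-sym s≢p) (≢-sym s≢q)
        r≤ (m∸n∸o≤m∸[n+k] N 2 1≤r) (m+n≤o⇒m≤o∸n 1 4≤N) k)

lemma3p3 : (N : ℕ) → 5 ≤ N → (M : ℕ) .{{_ : NonZero M}} → 3 ≤ M →
    (v : Fin M → Fin N) → Injective _≡_ _≡_ v →
    let open Sets N M v in
    (∀ x → ¬ (InX x × InY x)) × (∀ x → ¬ (InX x × InZ x)) × (∀ x → ¬ (InY x × InZ x))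
lemma3p3 N 5≤N M 3≤M v v-inj = X∩Y≡∅ , X∩Z≡∅ , Y∩Z≡∅
  where
  open Sets N M v

  v≢v∘plus2 : ∀ i → v i ≢ v (plus2 M i)
  v≢v∘plus2 i eq = plus2-≢ 3≤M i (sym (v-inj eq))

  N∸3<N∸2 : N ∸ 3 < N ∸ 2
  N∸3<N∸2 = ∸-monoʳ-< ≤-refl (m+n≤o⇒n≤o 2 5≤N)

  X∩Y≡∅ : ∀ x → ¬ (InX x × InY x)
  X∩Y≡∅ x (x∈X , x∈Y) with k , large ← InX⇒∃coordinate-≥ v x∈X =
    <⇒≱ N∸3<N∸2 (≤-trans large (InY⇒coordinate-≤ v v≢v∘plus2 x∈Y k))

  X∩Z≡∅ : ∀ x → ¬ (InX x × InZ x)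
  X∩Z≡∅ x (x∈X , x∈Z) with k , large ← InX⇒∃coordinate-≥ v x∈X =
    <⇒≱ N∸3<N∸2 (≤-trans large (InZ⇒coordinate-≤ v v≢v∘plus2 (m+n≤o⇒n≤o 1 5≤N) x∈Z k))

  Y∩Z≡∅ : ∀ x → ¬ (InY x × InZ x)
  Y∩Z≡∅ x (x∈Y , x∈Z) with k , xk≡1 ← InZ⇒∃coordinate-≡1 v x∈Z =
    InY⇒coordinate-≢1 v v≢v∘plus2 (m+n≤o⇒n≤o 2 5≤N) x∈Y k xk≡1
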